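{- Let $d \ge 1$ be an integer and let $G$ be a graph of order $n \ge 2d+1$ whose complement $\overline{G}$ is $d$-degenerate. Then \[ \Gamma_d(G) \le 2d + 1 + 2\ln\!\left(\frac{n-2d+1}{2}\right). \]
   Context: A graph is $d$-degenerate if every induced subgraph of it has a vertex of degree at most $d$. $\ln$ is the natural logarithm. For a digraph $D$, a directed dominating set is a set $S \subseteq V(D)$ such that every vertex $u \notin S$ has a vertex $v \in S$ with arc $(v,u)$; $\gamma(D)$ is the minimum size of such a set. For a graph $G$, $\Gamma_d(G) = \max\{\gamma(D) : D \text{ an orientation of } G\}$. -}

module Defs where

open import Data.Nat using (ℕ; zero; suc; _+_; _*_; _∸_; _^_; _≤_)
open import Data.Nat.Combinatorics using (_P_)
open import Data.Bool using (Bool; true; false; T; not; _∧_)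
open import Data.Fin using (Fin)
open import Data.Fin.Subset using (Subset; _∈_; _∉_; ∣_∣; Nonempty)
open import Data.List using (List; upTo; map)
open import Data.Nat.ListAction using (sum)
open import Data.Product using (Σ; ∃; _×_; _,_)
open import Data.Sum using (_⊎_)
open import Data.Empty using (⊥)
open import Relation.Binary.PropositionalEquality using (_≡_; _≢_)
open import Relation.Nullary using (¬_)
open import Relation.Nullary.Decidable using (⌊_⌋; does)
open import Data.Fin.Properties using (_≟_)
open import Data.List.Base using (length; filterᵇ)
open import Data.List using (allFin)

record Graph (n : ℕ) : Set where
  field
    adj    : Fin n → Fin n → Bool
    adj-sym    : ∀ u v → adj u v ≡ adj v u
    adj-irrefl : ∀ v → adj v v ≡ false
open Graph public

complement : ∀ {n} → Graph n → Graph n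
complement {n} G = record
  { adj = cadj
  ; adj-sym = csym
  ; adj-irrefl = cirr }
  where
  cadj : Fin n → Fin n → Bool
  cadj u v = not (does (u ≟ v)) ∧ not (adj G u v)
  csym : ∀ u v → cadj u v ≡ cadj v u
  csym u v with u ≟ v | v ≟ u
  ... | Relation.Nullary.yes _ | Relation.Nullary.yes _ = Relation.Binary.PropositionalEquality.refl
  ... | Relation.Nullary.yes p | Relation.Nullary.no q = ⊥-elim' (q (Relation.Binary.PropositionalEquality.sym p))
    where ⊥-elim' : ∀ {A : Set} → ⊥ → A
          ⊥-elim' ()
  ... | Relation.Nullary.no p | Relation.Nullary.yes q = ⊥-elim' (p (Relation.Binary.PropositionalEquality.sym q))
    where ⊥-elim' : ∀ {A : Set} → ⊥ → A
          ⊥-elim' ()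
  ... | Relation.Nullary.no _ | Relation.Nullary.no _ =
    Relation.Binary.PropositionalEquality.cong not (adj-sym G u v)
  cirr : ∀ v → cadj v v ≡ false
  cirr v with v ≟ v
  ... | Relation.Nullary.yes _ = Relation.Binary.PropositionalEquality.refl
  ... | Relation.Nullary.no p = ⊥-elim' (p Relation.Binary.PropositionalEquality.refl)
    where ⊥-elim' : ∀ {A : Set} → ⊥ → A
          ⊥-elim' ()

degIn : ∀ {n} → Graph n → Subset n → Fin n → ℕ
degIn {n} G S v = length (filterᵇ (λ w → does (Data.Fin.Subset.Properties._∈?_ w S) ∧ adj G v w) (allFin n))
  where import Data.Fin.Subset.Properties

Degenerate : ∀ {n} → ℕ → Graph n → Set
Degenerate d G = ∀ S → Nonempty S → ∃ λ v → v ∈ S × degIn G S v ≤ d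

record Orientation {n : ℕ} (G : Graph n) : Set where
  field
    arc       : Fin n → Fin n → Bool
    arc⇒edge  : ∀ u v → arc u v ≡ true → adj G u v ≡ true
    edge⇒arc  : ∀ u v → adj G u v ≡ true → (arc u v ≡ true) ⊎ (arc v u ≡ true)
    antisym   : ∀ u v → arc u v ≡ true → arc v u ≡ false
open Orientation public

Dominating : ∀ {n} {G : Graph n} → Orientation G → Subset n → Set
Dominating {n} D S = ∀ u → u ∉ S → ∃ λ v → v ∈ S × arc D v u ≡ true

IsDomNumber : ∀ {n} {G : Graph n} → Orientation G → ℕ → Set
IsDomNumber D k =
  (∃ λ S → Dominating D S × ∣ S ∣ ≡ k) × (∀ S → Dominating D S → k ≤ ∣ S ∣)

IsOrientedDomNumber : ∀ {n} → Graph n → ℕ → Set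
IsOrientedDomNumber G k =
  (∃ λ D → IsDomNumber {G = G} D k) × (∀ D j → IsDomNumber {G = G} D j → j ≤ k)

-- The real bound  k ≤ 2d + 1 + 2 ln((n - 2d + 1)/2), for n ≥ 2d+1,
-- encoded in ℕ.  With m = k ∸ (2d+1) and x = (n - 2d + 1)/2 ≥ 1, the bound is
-- equivalent to  e^m ≤ x² , i.e. 4 e^m ≤ (n - 2d + 1)²  (if k ≤ 2d+1 then
-- m = 0 and both sides hold trivially).  Since the partial sums of
-- e^m = Σ_j m^j / j! increase to e^m, this holds iff for every N,
--   4 · Σ_{j=0}^{N} m^j · N!/j!  ≤  (n - 2d + 1)² · N!,
-- where N!/j! = N P (N ∸ j).

expPartialScaled : ℕ → ℕ → ℕ
expPartialScaled m N = sum (map (λ j → m ^ j * (N P (N ∸ j))) (upTo (suc N)))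

LnBound : (d n k : ℕ) → Set
LnBound d n k =
  ∀ N → 4 * expPartialScaled (k ∸ (2 * d + 1)) N
        ≤ ((n ∸ 2 * d) + 1) ^ 2 * (N P N)

-- Write F = n - 2d + 1.  In an orientation D of G, a vertex set Q with r elements
-- spans at least r(r-1)/2 - dr arcs, because the complement of G restricted to Q is
-- d-degenerate; so some v in Q has at least (r - 2d - 1)/2 out-neighbours in Q.  Put v
-- into the dominating set and delete v together with its out-neighbours: the excess
-- |Q| + 1 - 2d at least halves.  Starting from Q = V and F < 2^(t+1), after t steps at
-- most 2d vertices are left, and they are taken as well; hence γ(D) ≤ 2d + ⌊log₂ F⌋.
-- Since e < 4, this gives e^(γ - 2d - 1) ≤ 4^(⌊log₂ F⌋ - 1) ≤ (F/2)^2.  In ℕ the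
-- inequality e^m ≤ 4^m is proved on the partial sums of the exponential series, from
-- m^j / j! ≤ ((2m multichoose j)) / 2^j and the negative binomial series
-- Σ_j ((a multichoose j)) / 2^j = 2^a.

{-# OPTIONS --safe #-}
module Submission where

open import Defs
open import Data.Nat
  using (ℕ; zero; suc; _+_; _*_; _∸_; _^_; _≤_; _<_; z≤n; s≤s; z<s; _!; >-nonZero)
open import Data.Nat.Properties hiding (_≟_)
open import Data.Nat.Combinatorics using (_P_; nPn≡n!)
open import Data.Nat.Combinatorics.Specification using (nPk≡n!/[n∸k]!)
open import Data.Nat.DivMod using (_/_; m/n*n≡m; /-congʳ)
import Algebra.Properties.CommutativeSemigroup *-commutativeSemigroup as *-CS
open import Data.Nat.Divisibility using (m≤n⇒m!∣n!)
open import Data.Nat.Tactic.RingSolver using (solve-∀)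
open import Data.Fin using (Fin; zero; suc; toℕ)
open import Data.Fin.Properties using (toℕ≤pred[n]; _≟_; any?)
import Data.Bool.Properties as Bool
open import Data.Product using (∃; _×_; _,_)
open import Data.Sum using (_⊎_; inj₁; inj₂)
open import Data.Bool using (Bool; true; false; not; _∧_; _∨_)
open import Relation.Nullary using (does; yes; no; contradiction)
open import Relation.Nullary.Decidable using (dec-true; dec-false; _×-dec_)
open import Data.List using (applyUpTo; map; filterᵇ; length)
import Data.List as List
open import Data.Vec using (lookup; tabulate; _∷_)
open import Data.Vec.Properties using (lookup∘tabulate; []=⇒lookup; lookup⇒[]=)
open import Data.Fin.Subset using (Subset; _∈_; ∣_∣)
open import Data.Fin.Subset.Properties using (_∈?_)
import Data.Nat.ListAction as ListAction
open import Function using (_∘′_; id)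
open import Algebra.Properties.Semiring.Sum +-*-semiring
  using (sum-syntax; ∑-distrib-+; *-distribˡ-sum; *-distribʳ-sum; sum-cong-≗; sum-replicate-zero)
open import Relation.Binary.PropositionalEquality

∑-mono-≤ : ∀ {n} {f g : Fin n → ℕ} → (∀ i → f i ≤ g i) → ∑[ i < n ] f i ≤ ∑[ i < n ] g i
∑-mono-≤ {zero}  f≤g = z≤n
∑-mono-≤ {suc n} {f} {g} f≤g =
  +-mono-≤ (f≤g zero) (∑-mono-≤ {f = f ∘′ suc} {g ∘′ suc} (λ i → f≤g (suc i)))

listSum-map-applyUpTo : ∀ (f g : ℕ → ℕ) n →
                        ListAction.sum (map f (applyUpTo g n)) ≡ ∑[ i < n ] f (g (toℕ i))
listSum-map-applyUpTo f g zero    = refl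
listSum-map-applyUpTo f g (suc n) = cong (f (g 0) +_) (listSum-map-applyUpTo f (g ∘′ suc) n)

-- Partial sums of the exponential series

multichoose : ℕ → ℕ → ℕ
multichoose a       zero    = 1
multichoose zero    (suc j) = 0
multichoose (suc a) (suc j) = multichoose a (suc j) + multichoose (suc a) j

risingFactorial : ℕ → ℕ → ℕ
risingFactorial a zero    = 1
risingFactorial a (suc j) = a * risingFactorial (suc a) j

risingFactorial-suc : ∀ a j → risingFactorial a (suc j) ≡ risingFactorial a j * (a + j)
risingFactorial-suc a zero    = trans (*-identityʳ a) (sym (trans (*-identityˡ (a + 0)) (+-identityʳ a)))
risingFactorial-suc a (suc j) = begin
  a * risingFactorial (suc a) (suc j)           ≡⟨ cong (a *_) (risingFactorial-suc (suc a) j) ⟩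
  a * (risingFactorial (suc a) j * (suc a + j)) ≡⟨ *-assoc a _ _ ⟨
  a * risingFactorial (suc a) j * (suc a + j)   ≡⟨ cong (a * risingFactorial (suc a) j *_) (+-suc a j) ⟨
  a * risingFactorial (suc a) j * (a + suc j)   ∎
  where open ≡-Reasoning

!*multichoose≡risingFactorial : ∀ a j → j ! * multichoose a j ≡ risingFactorial a j
!*multichoose≡risingFactorial a       zero    = refl
!*multichoose≡risingFactorial zero    (suc j) = *-zeroʳ (suc j !)
!*multichoose≡risingFactorial (suc a) (suc j) = begin
  suc j ! * (multichoose a (suc j) + multichoose (suc a) j)
    ≡⟨ *-distribˡ-+ (suc j !) _ _ ⟩
  suc j ! * multichoose a (suc j) + suc j * j ! * multichoose (suc a) j
    ≡⟨ cong (suc j ! * multichoose a (suc j) +_) (*-assoc (suc j) (j !) _) ⟩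
  suc j ! * multichoose a (suc j) + suc j * (j ! * multichoose (suc a) j)
    ≡⟨ cong₂ (λ x y → x + suc j * y) (!*multichoose≡risingFactorial a (suc j))
                                      (!*multichoose≡risingFactorial (suc a) j) ⟩
  a * R + suc j * R  ≡⟨ *-distribʳ-+ R a (suc j) ⟨
  (a + suc j) * R    ≡⟨ cong (_* R) (+-suc a j) ⟩
  (suc a + j) * R    ≡⟨ *-comm (suc a + j) R ⟩
  R * (suc a + j)    ≡⟨ risingFactorial-suc (suc a) j ⟨
  risingFactorial (suc a) (suc j) ∎
  where
  open ≡-Reasoning
  R = risingFactorial (suc a) j

^≤risingFactorial : ∀ {a b} j → a ≤ b → a ^ j ≤ risingFactorial b j
^≤risingFactorial zero    a≤b = ≤-refl
^≤risingFactorial (suc j) a≤b = *-mono-≤ a≤b (^≤risingFactorial j (m≤n⇒m≤1+n a≤b))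

^≤!*multichoose : ∀ a j → a ^ j ≤ j ! * multichoose a j
^≤!*multichoose a j =
  ≤-trans (^≤risingFactorial j ≤-refl) (≤-reflexive (sym (!*multichoose≡risingFactorial a j)))

multichooseSum : ℕ → ℕ → ℕ
multichooseSum a N = ∑[ i < suc N ] (multichoose a (toℕ i) * 2 ^ (N ∸ toℕ i))

multichooseSum-suc : ∀ a N →
                     multichooseSum (suc a) (suc N) ≡ multichooseSum a (suc N) + multichooseSum (suc a) N
multichooseSum-suc a N = begin
  1 * 2 ^ suc N + ∑[ i < suc N ] ((x i + y i) * 2 ^ (N ∸ toℕ i))
    ≡⟨ cong (1 * 2 ^ suc N +_) (sum-cong-≗ (λ i → *-distribʳ-+ (2 ^ (N ∸ toℕ i)) (x i) (y i))) ⟩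
  1 * 2 ^ suc N + ∑[ i < suc N ] (x i * 2 ^ (N ∸ toℕ i) + y i * 2 ^ (N ∸ toℕ i))
    ≡⟨ cong (1 * 2 ^ suc N +_) (∑-distrib-+ (λ i → x i * 2 ^ (N ∸ toℕ i))
                                            (λ i → y i * 2 ^ (N ∸ toℕ i))) ⟩
  1 * 2 ^ suc N + (∑[ i < suc N ] (x i * 2 ^ (N ∸ toℕ i)) + multichooseSum (suc a) N)
    ≡⟨ +-assoc (1 * 2 ^ suc N) _ _ ⟨
  multichooseSum a (suc N) + multichooseSum (suc a) N ∎
  where
  open ≡-Reasoning
  x y : Fin (suc N) → ℕ
  x i = multichoose a (suc (toℕ i))
  y i = multichoose (suc a) (toℕ i)

multichooseSum≤2^ : ∀ a N → multichooseSum a N ≤ 2 ^ (a + N)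
multichooseSum≤2^ a       zero    = m^n>0 2 (a + 0)
multichooseSum≤2^ zero    (suc N) = ≤-reflexive (trans (cong (1 * 2 ^ suc N +_) (sum-replicate-zero (suc N)))
                                                         (trans (+-identityʳ _) (*-identityˡ _)))
multichooseSum≤2^ (suc a) (suc N) = begin
  multichooseSum (suc a) (suc N)
    ≡⟨ multichooseSum-suc a N ⟩
  multichooseSum a (suc N) + multichooseSum (suc a) N
    ≤⟨ +-mono-≤ (multichooseSum≤2^ a (suc N)) (multichooseSum≤2^ (suc a) N) ⟩
  2 ^ (a + suc N) + 2 ^ (suc a + N)                   ≡⟨ cong (λ e → 2 ^ e + 2 ^ (suc a + N)) (+-suc a N) ⟩
  2 ^ (suc a + N) + 2 ^ (suc a + N)                   ≡⟨ cong (2 ^ (suc a + N) +_) (+-identityʳ _) ⟨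
  2 ^ suc (suc a + N)                                 ≡⟨ cong (2 ^_) (+-suc (suc a) N) ⟨
  2 ^ (suc a + suc N)                                 ∎
  where open ≤-Reasoning

^-distrib-* : ∀ a b j → (a * b) ^ j ≡ a ^ j * b ^ j
^-distrib-* a b zero    = refl
^-distrib-* a b (suc j) = trans (cong (a * b *_) (^-distrib-* a b j)) (*-CS.interchange a b (a ^ j) (b ^ j))

P[∸]*!≡! : ∀ {N j} → j ≤ N → (N P (N ∸ j)) * j ! ≡ N !
P[∸]*!≡! {N} {j} j≤N = begin
  (N P (N ∸ j)) * j !             ≡⟨ cong (_* j !) (nPk≡n!/[n∸k]! (m∸n≤m N j)) ⟩
  N ! / (N ∸ (N ∸ j)) ! * j !     ≡⟨ cong (_* j !) (/-congʳ (cong _! (m∸[m∸n]≡n j≤N))) ⟩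
  N ! / j ! * j !                 ≡⟨ m/n*n≡m (m≤n⇒m!∣n! j≤N) ⟩
  N !                             ∎
  where
  open ≡-Reasoning
  instance
    _ = j !≢0
    _ = (N ∸ (N ∸ j)) !≢0

expTerm≤ : ∀ m N j → j ≤ N →
           m ^ j * (N P (N ∸ j)) * 2 ^ N ≤ N ! * (multichoose (2 * m) j * 2 ^ (N ∸ j))
expTerm≤ m N j j≤N = begin
  m ^ j * p * 2 ^ N                    ≡⟨ cong (λ e → m ^ j * p * 2 ^ e) (m+[n∸m]≡n j≤N) ⟨
  m ^ j * p * 2 ^ (j + (N ∸ j))        ≡⟨ cong (m ^ j * p *_) (^-distribˡ-+-* 2 j (N ∸ j)) ⟩
  m ^ j * p * (2 ^ j * 2 ^ (N ∸ j))    ≡⟨ *-CS.interchange (m ^ j) p (2 ^ j) (2 ^ (N ∸ j)) ⟩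
  m ^ j * 2 ^ j * (p * 2 ^ (N ∸ j))    ≡⟨ cong (_* (p * 2 ^ (N ∸ j))) (*-comm (m ^ j) (2 ^ j)) ⟩
  2 ^ j * m ^ j * (p * 2 ^ (N ∸ j))    ≡⟨ cong (_* (p * 2 ^ (N ∸ j))) (^-distrib-* 2 m j) ⟨
  (2 * m) ^ j * (p * 2 ^ (N ∸ j))      ≤⟨ *-monoˡ-≤ (p * 2 ^ (N ∸ j)) (^≤!*multichoose (2 * m) j) ⟩
  j ! * c * (p * 2 ^ (N ∸ j))          ≡⟨ *-CS.interchange (j !) c p (2 ^ (N ∸ j)) ⟩
  j ! * p * (c * 2 ^ (N ∸ j))          ≡⟨ cong (_* (c * 2 ^ (N ∸ j))) (*-comm (j !) p) ⟩
  p * j ! * (c * 2 ^ (N ∸ j))          ≡⟨ cong (_* (c * 2 ^ (N ∸ j))) (P[∸]*!≡! j≤N) ⟩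
  N ! * (c * 2 ^ (N ∸ j))              ∎
  where
  open ≤-Reasoning
  p = N P (N ∸ j)
  c = multichoose (2 * m) j

expPartialScaled≤4^*! : ∀ m N → expPartialScaled m N ≤ 4 ^ m * N !
expPartialScaled≤4^*! m N = *-cancelʳ-≤ _ _ (2 ^ N) {{m^n≢0 2 N}} (begin
  expPartialScaled m N * 2 ^ N
    ≡⟨ cong (_* 2 ^ N) (listSum-map-applyUpTo term id (suc N)) ⟩
  (∑[ i < suc N ] term (toℕ i)) * 2 ^ N
    ≡⟨ *-distribʳ-sum {suc N} (2 ^ N) (λ i → term (toℕ i)) ⟩
  ∑[ i < suc N ] (term (toℕ i) * 2 ^ N)
    ≤⟨ ∑-mono-≤ (λ i → expTerm≤ m N (toℕ i) (toℕ≤pred[n] i)) ⟩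
  ∑[ i < suc N ] (N ! * (multichoose (2 * m) (toℕ i) * 2 ^ (N ∸ toℕ i)))
    ≡⟨ *-distribˡ-sum {suc N} (N !) (λ i → multichoose (2 * m) (toℕ i) * 2 ^ (N ∸ toℕ i)) ⟨
  N ! * multichooseSum (2 * m) N
    ≤⟨ *-monoʳ-≤ (N !) (multichooseSum≤2^ (2 * m) N) ⟩
  N ! * 2 ^ (2 * m + N)
    ≡⟨ cong (N ! *_) (^-distribˡ-+-* 2 (2 * m) N) ⟩
  N ! * (2 ^ (2 * m) * 2 ^ N)
    ≡⟨ cong (λ x → N ! * (x * 2 ^ N)) (^-*-assoc 2 2 m) ⟨
  N ! * (4 ^ m * 2 ^ N)
    ≡⟨ *-CS.x∙yz≈yx∙z (N !) (4 ^ m) (2 ^ N) ⟩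
  4 ^ m * N ! * 2 ^ N ∎)
  where
  open ≤-Reasoning
  term : ℕ → ℕ
  term j = m ^ j * (N P (N ∸ j))

4^≡[2^]^2 : ∀ x → 4 ^ x ≡ (2 ^ x) ^ 2
4^≡[2^]^2 x = trans (^-*-assoc 2 2 x) (trans (cong (2 ^_) (*-comm 2 x)) (sym (^-*-assoc 2 x 2)))

lnBound : ∀ d n k → 2 ^ suc (k ∸ (2 * d + 1)) ≤ n ∸ 2 * d + 1 → LnBound d n k
lnBound d n k 2^≤F N = begin
  4 * expPartialScaled m N  ≤⟨ *-monoʳ-≤ 4 (expPartialScaled≤4^*! m N) ⟩
  4 * (4 ^ m * N !)         ≡⟨ *-assoc 4 (4 ^ m) (N !) ⟨
  4 ^ suc m * N !           ≡⟨ cong (_* N !) (4^≡[2^]^2 (suc m)) ⟩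
  (2 ^ suc m) ^ 2 * N !     ≤⟨ *-monoˡ-≤ (N !) (^-monoˡ-≤ 2 2^≤F) ⟩
  (n ∸ 2 * d + 1) ^ 2 * N ! ≡⟨ cong ((n ∸ 2 * d + 1) ^ 2 *_) (nPn≡n! N) ⟨
  (n ∸ 2 * d + 1) ^ 2 * (N P N) ∎
  where
  open ≤-Reasoning
  m = k ∸ (2 * d + 1)

-- Finite vertex sets as Boolean predicates

χ : Bool → ℕ
χ true  = 1
χ false = 0

sumOver : ∀ {n} → (Fin n → Bool) → (Fin n → ℕ) → ℕ
sumOver {n} Q f = ∑[ w < n ] (χ (Q w) * f w)

syntax sumOver Q (λ w → e) = ∑[ w ∈ Q ] e

card : ∀ {n} → (Fin n → Bool) → ℕ
card Q = ∑[ w ∈ Q ] 1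

_∖_ : ∀ {n} → (Fin n → Bool) → (Fin n → Bool) → Fin n → Bool
(Q ∖ R) w = Q w ∧ not (R w)

⁅_⁆ : ∀ {n} → Fin n → Fin n → Bool
⁅ v ⁆ w = does (w ≟ v)

_∪_ : ∀ {n} → (Fin n → Bool) → (Fin n → Bool) → Fin n → Bool
(S ∪ R) w = S w ∨ R w

⁅⁆-self : ∀ {n} (v : Fin n) → ⁅ v ⁆ v ≡ true
⁅⁆-self v = dec-true (v ≟ v) refl

∖⁅⁆-self : ∀ {n} (Q : Fin n → Bool) v → (Q ∖ ⁅ v ⁆) v ≡ false
∖⁅⁆-self Q v = trans (cong (λ b → Q v ∧ not b) (⁅⁆-self v)) (Bool.∧-zeroʳ (Q v))

∪-introˡ : ∀ {n} (S R : Fin n → Bool) {w} → S w ≡ true → (S ∪ R) w ≡ true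
∪-introˡ S R Sw rewrite Sw = refl

∪-introʳ : ∀ {n} (S R : Fin n → Bool) {w} → R w ≡ true → (S ∪ R) w ≡ true
∪-introʳ S R {w} Rw rewrite Rw = Bool.∨-zeroʳ (S w)

∈-∖ : ∀ {n} (Q R : Fin n → Bool) {w} → Q w ≡ true → R w ≡ false → (Q ∖ R) w ≡ true
∈-∖ Q R Qw ¬Rw rewrite Qw | ¬Rw = refl

∑∈⁅⁆ : ∀ {n} (v : Fin n) (f : Fin n → ℕ) → ∑[ w ∈ ⁅ v ⁆ ] f w ≡ f v
∑∈⁅⁆ {suc n} zero    f =
  trans (cong (1 * f zero +_) (sum-replicate-zero n)) (trans (+-identityʳ _) (*-identityˡ _))
∑∈⁅⁆ {suc n} (suc v) f = ∑∈⁅⁆ v (f ∘′ suc)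

card⁅⁆ : ∀ {n} (v : Fin n) → card ⁅ v ⁆ ≡ 1
card⁅⁆ v = ∑∈⁅⁆ v (λ _ → 1)

card-all : ∀ {n} → card {n} (λ _ → true) ≡ n
card-all {zero}  = refl
card-all {suc n} = cong suc (card-all {n})

module _ {n : ℕ} (Q : Fin n → Bool) where

  ∑∈-cong : {f g : Fin n → ℕ} → (∀ w → Q w ≡ true → f w ≡ g w) → sumOver Q f ≡ sumOver Q g
  ∑∈-cong f≡g = sum-cong-≗ {n} pointwise
    where
    pointwise : ∀ w → χ (Q w) * _ ≡ χ (Q w) * _
    pointwise w with Q w in Qw
    ... | true  = cong (1 *_) (f≡g w Qw)
    ... | false = refl

  ∑∈-mono-≤ : {f g : Fin n → ℕ} → (∀ w → Q w ≡ true → f w ≤ g w) → sumOver Q f ≤ sumOver Q g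
  ∑∈-mono-≤ f≤g = ∑-mono-≤ pointwise
    where
    pointwise : ∀ w → χ (Q w) * _ ≤ χ (Q w) * _
    pointwise w with Q w in Qw
    ... | true  = *-monoʳ-≤ 1 (f≤g w Qw)
    ... | false = z≤n

  ∑∈-+ : (f g : Fin n → ℕ) → ∑[ w ∈ Q ] (f w + g w) ≡ sumOver Q f + sumOver Q g
  ∑∈-+ f g = trans (sum-cong-≗ {n} (λ w → *-distribˡ-+ (χ (Q w)) (f w) (g w))) (∑-distrib-+ {n} _ _)

  ∑∈-*ˡ : (c : ℕ) (f : Fin n → ℕ) → ∑[ w ∈ Q ] (c * f w) ≡ c * sumOver Q f
  ∑∈-*ˡ c f =
    trans (sum-cong-≗ {n} (λ w → *-CS.x∙yz≈y∙xz (χ (Q w)) c (f w))) (sym (*-distribˡ-sum {n} c _))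

  ∑∈-const : (c : ℕ) → ∑[ w ∈ Q ] c ≡ c * card Q
  ∑∈-const c =
    trans (sum-cong-≗ {n} (λ w → cong (χ (Q w) *_) (sym (*-identityʳ c)))) (∑∈-*ˡ c (λ _ → 1))

  ∑∈-remove : ∀ {v} (f : Fin n → ℕ) → Q v ≡ true → sumOver Q f ≡ sumOver (Q ∖ ⁅ v ⁆) f + f v
  ∑∈-remove {v} f Qv = begin
    sumOver Q f                                     ≡⟨ sum-cong-≗ {n} pointwise ⟩
    ∑[ w < n ] (χ ((Q ∖ ⁅ v ⁆) w) * f w + χ (⁅ v ⁆ w) * f w) ≡⟨ ∑-distrib-+ {n} _ _ ⟩
    sumOver (Q ∖ ⁅ v ⁆) f + sumOver ⁅ v ⁆ f          ≡⟨ cong (sumOver (Q ∖ ⁅ v ⁆) f +_) (∑∈⁅⁆ v f) ⟩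
    sumOver (Q ∖ ⁅ v ⁆) f + f v                      ∎
    where
    open ≡-Reasoning
    pointwise : ∀ w → χ (Q w) * f w ≡ χ (Q w ∧ not (does (w ≟ v))) * f w + χ (does (w ≟ v)) * f w
    pointwise w with w ≟ v
    ... | yes refl rewrite Qv = refl
    ... | no _ with Q w
    ...   | true  = sym (+-identityʳ _)
    ...   | false = refl

  card-∖ : (R : Fin n → Bool) → card Q ≡ ∑[ w ∈ Q ] χ (R w) + card (Q ∖ R)
  card-∖ R = trans (sum-cong-≗ {n} (λ w → χ-split (Q w) (R w))) (∑-distrib-+ {n} _ _)
    where
    χ-split : ∀ q r → χ q * 1 ≡ χ q * χ r + χ (q ∧ not r) * 1
    χ-split true  true  = refl
    χ-split true  false = refl
    χ-split false r     = refl

  card-∪ : (R : Fin n → Bool) → card (Q ∪ R) ≤ card Q + card R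
  card-∪ R = ≤-trans (∑-mono-≤ (λ w → χ-∨ (Q w) (R w))) (≤-reflexive (∑-distrib-+ {n} _ _))
    where
    χ-∨ : ∀ q r → χ (q ∨ r) * 1 ≤ χ q * 1 + χ r * 1
    χ-∨ true  r = m≤m+n 1 (χ r * 1)
    χ-∨ false r = ≤-refl

  card>0⇒nonempty : 0 < card Q → ∃ λ v → Q v ≡ true
  card>0⇒nonempty 0<card with any? (λ v → Q v Bool.≟ true)
  ... | yes nonempty = nonempty
  ... | no  empty    =
    contradiction (trans (∑∈-cong (λ w Qw → contradiction (w , Qw) empty)) (∑∈-const 0)) (>⇒≢ 0<card)

pairs : ∀ {n} → (Fin n → Fin n → Bool) → (Fin n → Bool) → ℕ
pairs R Q = ∑[ u ∈ Q ] (∑[ w ∈ Q ] χ (R u w))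

pairs-remove : ∀ {n} (R : Fin n → Fin n → Bool) {Q : Fin n → Bool} {v} →
               R v v ≡ false → Q v ≡ true →
               pairs R Q ≡ pairs R (Q ∖ ⁅ v ⁆) + ∑[ w ∈ Q ∖ ⁅ v ⁆ ] χ (R v w)
                                               + ∑[ u ∈ Q ∖ ⁅ v ⁆ ] χ (R u v)
pairs-remove R {Q} {v} Rvv Qv = begin
  ∑[ u ∈ Q ] (∑[ w ∈ Q ] χ (R u w))
    ≡⟨ ∑∈-cong Q (λ u _ → ∑∈-remove Q (λ w → χ (R u w)) Qv) ⟩
  ∑[ u ∈ Q ] (∑[ w ∈ Q' ] χ (R u w) + χ (R u v))
    ≡⟨ ∑∈-+ Q (λ u → ∑[ w ∈ Q' ] χ (R u w)) (λ u → χ (R u v)) ⟩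
  ∑[ u ∈ Q ] (∑[ w ∈ Q' ] χ (R u w)) + ∑[ u ∈ Q ] χ (R u v)
    ≡⟨ cong₂ _+_ (∑∈-remove Q (λ u → ∑[ w ∈ Q' ] χ (R u w)) Qv)
                 (∑∈-remove Q (λ u → χ (R u v)) Qv) ⟩
  pairs R Q' + ∑[ w ∈ Q' ] χ (R v w) + (∑[ u ∈ Q' ] χ (R u v) + χ (R v v))
    ≡⟨ cong (λ b → pairs R Q' + ∑[ w ∈ Q' ] χ (R v w) + (∑[ u ∈ Q' ] χ (R u v) + χ b)) Rvv ⟩
  pairs R Q' + ∑[ w ∈ Q' ] χ (R v w) + (∑[ u ∈ Q' ] χ (R u v) + 0)
    ≡⟨ cong (pairs R Q' + ∑[ w ∈ Q' ] χ (R v w) +_) (+-identityʳ _) ⟩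
  pairs R Q' + ∑[ w ∈ Q' ] χ (R v w) + ∑[ u ∈ Q' ] χ (R u v) ∎
  where
  open ≡-Reasoning
  Q' = Q ∖ ⁅ v ⁆

∈-tabulate⁺ : ∀ {n} {Q : Fin n → Bool} {w} → Q w ≡ true → w ∈ tabulate Q
∈-tabulate⁺ {Q = Q} {w} Qw = lookup⇒[]= w (tabulate Q) (trans (lookup∘tabulate Q w) Qw)

∈-tabulate⁻ : ∀ {n} {Q : Fin n → Bool} {w} → w ∈ tabulate Q → Q w ≡ true
∈-tabulate⁻ {Q = Q} {w} w∈ = trans (sym (lookup∘tabulate Q w)) ([]=⇒lookup w∈)

∣tabulate∣≡card : ∀ {n} (Q : Fin n → Bool) → ∣ tabulate Q ∣ ≡ card Q
∣tabulate∣≡card {zero}  Q = refl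
∣tabulate∣≡card {suc n} Q with Q zero
... | true  = cong suc (∣tabulate∣≡card (Q ∘′ suc))
... | false = ∣tabulate∣≡card (Q ∘′ suc)

does-∈? : ∀ {n} (w : Fin n) (S : Subset n) → does (w ∈? S) ≡ lookup S w
does-∈? zero    (true  ∷ S) = refl
does-∈? zero    (false ∷ S) = refl
does-∈? (suc w) (b ∷ S)     = does-∈? w S

length-filterᵇ-tabulate : ∀ {A : Set} {n} (p : A → Bool) (f : Fin n → A) →
                          length (filterᵇ p (List.tabulate f)) ≡ ∑[ i < n ] χ (p (f i))
length-filterᵇ-tabulate {n = zero}  p f = refl
length-filterᵇ-tabulate {n = suc n} p f with p (f zero)
... | true  = cong suc (length-filterᵇ-tabulate p (f ∘′ suc))
... | false = length-filterᵇ-tabulate p (f ∘′ suc)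

degIn-tabulate : ∀ {n} (H : Graph n) (Q : Fin n → Bool) v →
                 degIn H (tabulate Q) v ≡ ∑[ w ∈ Q ] χ (adj H v w)
degIn-tabulate {n} H Q v =
  trans (length-filterᵇ-tabulate (λ w → does (w ∈? tabulate Q) ∧ adj H v w) id) (sum-cong-≗ {n} pointwise)
  where
  pointwise : ∀ w → χ (does (w ∈? tabulate Q) ∧ adj H v w) ≡ χ (Q w) * χ (adj H v w)
  pointwise w rewrite does-∈? w (tabulate Q) | lookup∘tabulate Q w with Q w
  ... | true  = sym (+-identityʳ _)
  ... | false = refl

-- Orientations of a graph with a degenerate complement

module _ {n} {G : Graph n} (D : Orientation G) where

  arc-irrefl : ∀ v → arc D v v ≡ false
  arc-irrefl v with arc D v v in a
  ... | true  = trans (sym a) (antisym D v v a)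
  ... | false = refl

  arc-absent : ∀ {u w} → adj G u w ≡ false → arc D u w ≡ false
  arc-absent {u} {w} ¬uw with arc D u w in a
  ... | true  = trans (sym (arc⇒edge D u w a)) ¬uw
  ... | false = refl

  arc-trichotomy : ∀ {v w} → w ≢ v → χ (arc D v w) + χ (arc D w v) + χ (adj (complement G) v w) ≡ 1
  arc-trichotomy {v} {w} w≢v with v ≟ w
  ... | yes refl = contradiction refl w≢v
  ... | no _ with adj G v w in vw
  ...   | true with edge⇒arc D v w vw
  ...     | inj₁ v→w rewrite v→w | antisym D v w v→w = refl
  ...     | inj₂ w→v rewrite w→v | antisym D w v w→v = refl
  arc-trichotomy {v} {w} w≢v | no _ | false
    rewrite arc-absent vw | arc-absent (trans (adj-sym G w v) vw) = refl

  outDeg inDeg nonDeg : (Fin n → Bool) → Fin n → ℕ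
  outDeg Q v = ∑[ w ∈ Q ] χ (arc D v w)
  inDeg  Q v = ∑[ w ∈ Q ] χ (arc D w v)
  nonDeg Q v = ∑[ w ∈ Q ] χ (adj (complement G) v w)

  arcs : (Fin n → Bool) → ℕ
  arcs = pairs (arc D)

  degrees-partition : ∀ Q {v} → Q v ≡ false → outDeg Q v + inDeg Q v + nonDeg Q v ≡ card Q
  degrees-partition Q {v} ¬Qv = begin
    outDeg Q v + inDeg Q v + nonDeg Q v
      ≡⟨ cong (_+ nonDeg Q v) (∑∈-+ Q (λ w → χ (arc D v w)) (λ w → χ (arc D w v))) ⟨
    ∑[ w ∈ Q ] (χ (arc D v w) + χ (arc D w v)) + nonDeg Q v
      ≡⟨ ∑∈-+ Q (λ w → χ (arc D v w) + χ (arc D w v)) (λ w → χ (adj (complement G) v w)) ⟨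
    ∑[ w ∈ Q ] (χ (arc D v w) + χ (arc D w v) + χ (adj (complement G) v w))
      ≡⟨ ∑∈-cong Q (λ w Qw → arc-trichotomy (≢v Qw)) ⟩
    card Q ∎
    where
    open ≡-Reasoning
    ≢v : ∀ {w} → Q w ≡ true → w ≢ v
    ≢v Qw refl with trans (sym Qw) ¬Qv
    ... | ()

  outDeg-∖⁅⁆ : ∀ Q {v} → Q v ≡ true → outDeg (Q ∖ ⁅ v ⁆) v ≡ outDeg Q v
  outDeg-∖⁅⁆ Q {v} Qv = begin
    outDeg (Q ∖ ⁅ v ⁆) v                        ≡⟨ +-identityʳ _ ⟨
    outDeg (Q ∖ ⁅ v ⁆) v + 0                    ≡⟨ cong (λ b → outDeg (Q ∖ ⁅ v ⁆) v + χ b) (arc-irrefl v) ⟨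
    outDeg (Q ∖ ⁅ v ⁆) v + χ (arc D v v)        ≡⟨ ∑∈-remove Q (λ w → χ (arc D v w)) Qv ⟨
    outDeg Q v                                  ∎
    where open ≡-Reasoning

  card-∖closedOutNbhd : ∀ Q {v} → Q v ≡ true → card Q ≡ suc (outDeg Q v + card ((Q ∖ ⁅ v ⁆) ∖ arc D v))
  card-∖closedOutNbhd Q {v} Qv = begin
    card Q                                ≡⟨ ∑∈-remove Q (λ _ → 1) Qv ⟩
    card Q' + 1                           ≡⟨ +-comm _ 1 ⟩
    suc (card Q')                         ≡⟨ cong suc (card-∖ Q' (arc D v)) ⟩
    suc (outDeg Q' v + card (Q' ∖ arc D v)) ≡⟨ cong (λ o → suc (o + card (Q' ∖ arc D v))) (outDeg-∖⁅⁆ Q Qv) ⟩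
    suc (outDeg Q v + card (Q' ∖ arc D v))  ∎
    where
    open ≡-Reasoning
    Q' = Q ∖ ⁅ v ⁆

  Dominates : (Fin n → Bool) → (Fin n → Bool) → Set
  Dominates S Q = ∀ u → Q u ≡ true → S u ≡ true ⊎ ∃ λ v → S v ≡ true × arc D v u ≡ true

  dominating-tabulate : ∀ {S} → Dominates S (λ _ → true) → Dominating D (tabulate S)
  dominating-tabulate {S} S-dom u u∉S with S-dom u refl
  ... | inj₁ Su            = contradiction (∈-tabulate⁺ Su) u∉S
  ... | inj₂ (v , Sv , v→u) = v , ∈-tabulate⁺ Sv , v→u

square-suc-≤ : ∀ {r a o i c d} → r * r ≤ 2 * a + (2 * d + 1) * r → o + i + c ≡ r → c ≤ d →
               suc r * suc r ≤ 2 * (a + o + i) + (2 * d + 1) * suc r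
square-suc-≤ {r} {a} {o} {i} {c} {d} ih o+i+c≡r c≤d = begin
  suc r * suc r                                ≡⟨ expand r ⟩
  r * r + (2 * r + 1)                          ≤⟨ +-mono-≤ ih (+-monoˡ-≤ 1 (*-monoʳ-≤ 2 r≤o+i+d)) ⟩
  2 * a + (2 * d + 1) * r + (2 * (o + i + d) + 1) ≡⟨ regroup r a o i d ⟩
  2 * (a + o + i) + (2 * d + 1) * suc r        ∎
  where
  open ≤-Reasoning
  r≤o+i+d : r ≤ o + i + d
  r≤o+i+d = subst (_≤ o + i + d) o+i+c≡r (+-monoʳ-≤ (o + i) c≤d)
  expand : ∀ r → suc r * suc r ≡ r * r + (2 * r + 1)
  expand = solve-∀
  regroup : ∀ r a o i d → 2 * a + (2 * d + 1) * r + (2 * (o + i + d) + 1)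
                        ≡ 2 * (a + o + i) + (2 * d + 1) * suc r
  regroup = solve-∀

-- Deleting v and its o out-neighbours from Q, where |Q| = 1 + o + r ≤ 2o + 2d + 1,
-- at least halves the excess: 2 (r + 1 - 2d) ≤ |Q| + 1 - 2d.
excess-halves : ∀ {o r d B} → suc (o + r) ≤ 2 * o + (2 * d + 1) →
                suc (o + r) + 1 < 2 * d + 2 * B → r + 1 < 2 * d + B
excess-halves {o} {r} {d} {B} upper small = *-cancelˡ-< 2 (r + 1) (2 * d + B) (begin-strict
  2 * (r + 1)              ≤⟨ +-cancelʳ-≤ (2 * o) (2 * (r + 1)) (suc (o + r) + 1 + 2 * d) twice ⟩
  suc (o + r) + 1 + 2 * d  <⟨ +-monoˡ-< (2 * d) small ⟩
  2 * d + 2 * B + 2 * d    ≡⟨ regroup d B ⟩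
  2 * (2 * d + B)          ∎)
  where
  open ≤-Reasoning
  twice : 2 * (r + 1) + 2 * o ≤ suc (o + r) + 1 + 2 * d + 2 * o
  twice = begin
    2 * (r + 1) + 2 * o          ≡⟨ double o r ⟩
    suc (o + r) + suc (o + r)    ≤⟨ +-monoʳ-≤ (suc (o + r)) upper ⟩
    suc (o + r) + (2 * o + (2 * d + 1)) ≡⟨ shuffle o r d ⟩
    suc (o + r) + 1 + 2 * d + 2 * o  ∎
    where
    double : ∀ o r → 2 * (r + 1) + 2 * o ≡ suc (o + r) + suc (o + r)
    double = solve-∀
    shuffle : ∀ o r d → suc (o + r) + (2 * o + (2 * d + 1)) ≡ suc (o + r) + 1 + 2 * d + 2 * o
    shuffle = solve-∀
  regroup : ∀ d B → 2 * d + 2 * B + 2 * d ≡ 2 * (2 * d + B)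
  regroup = solve-∀

log₂-bracket : ∀ F → 0 < F → ∃ λ t → 2 ^ t ≤ F × F < 2 ^ suc t
log₂-bracket (suc zero)    _ = 0 , ≤-refl , s≤s (s≤s z≤n)
log₂-bracket (suc (suc F)) _ with log₂-bracket (suc F) z<s
... | t , lower , upper with suc (suc F) <? 2 ^ suc t
... | yes F+2<2^[1+t] = t , m≤n⇒m≤1+n lower , F+2<2^[1+t]
... | no  F+2≮2^[1+t] =
  suc t , ≮⇒≥ F+2≮2^[1+t] , ≤-<-trans upper (^-monoʳ-< 2 (s≤s (s≤s z≤n)) (n<1+n (suc t)))

2≤n∸m+1 : ∀ m {n} → m + 1 ≤ n → 2 ≤ n ∸ m + 1
2≤n∸m+1 m m+1≤n = +-monoˡ-≤ 1 (m+n≤o⇒m≤o∸n 1 (≤-trans (≤-reflexive (+-comm 1 m)) m+1≤n))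

2^suc[k∸[c+1]]≤ : ∀ c t {k F} → k ≤ c + t → 2 ≤ F → 2 ^ t ≤ F → 2 ^ suc (k ∸ (c + 1)) ≤ F
2^suc[k∸[c+1]]≤ c zero {k} k≤c+0 2≤F _
  rewrite m≤n⇒m∸n≡0 (≤-trans k≤c+0 (+-monoʳ-≤ c (z≤n {1}))) = 2≤F
2^suc[k∸[c+1]]≤ c (suc t) {k} k≤c+1+t _ 2^[1+t]≤F =
  ≤-trans (^-monoʳ-≤ 2 (s≤s (m≤n+o⇒m∸n≤o k (c + 1) k≤[c+1]+t))) 2^[1+t]≤F
  where
  k≤[c+1]+t : k ≤ c + 1 + t
  k≤[c+1]+t = subst (k ≤_) (sym (+-assoc c 1 t)) k≤c+1+t

module _ {n} {G : Graph n} (D : Orientation G) {d} (degenerate : Degenerate d (complement G)) where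

  card²≤arcs : ∀ r Q → card Q ≡ r → r * r ≤ 2 * arcs D Q + (2 * d + 1) * r
  card²≤arcs zero    Q _     = z≤n
  card²≤arcs (suc r) Q |Q|≡1+r with card>0⇒nonempty Q (subst (0 <_) (sym |Q|≡1+r) z<s)
  ... | v₀ , Qv₀ with degenerate (tabulate Q) (v₀ , ∈-tabulate⁺ Qv₀)
  ... | v , v∈Q , deg≤d =
    subst (λ a → suc r * suc r ≤ 2 * a + (2 * d + 1) * suc r)
          (sym (pairs-remove (arc D) {Q} (arc-irrefl D v) Qv))
          (square-suc-≤ {a = arcs D Q'} {o = outDeg D Q' v} {i = inDeg D Q' v}
                        (card²≤arcs r Q' |Q'|≡r) partition nonDeg≤d)
    where
    Qv : Q v ≡ true
    Qv = ∈-tabulate⁻ v∈Q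
    Q' = Q ∖ ⁅ v ⁆
    |Q'|≡r : card Q' ≡ r
    |Q'|≡r = suc-injective (trans (sym (trans (∑∈-remove Q (λ _ → 1) Qv) (+-comm _ 1))) |Q|≡1+r)
    partition : outDeg D Q' v + inDeg D Q' v + nonDeg D Q' v ≡ r
    partition = trans (degrees-partition D Q' (∖⁅⁆-self Q v)) |Q'|≡r
    nonDeg≤d : nonDeg D Q' v ≤ d
    nonDeg≤d = begin
      nonDeg D Q' v                                     ≤⟨ m≤m+n _ _ ⟩
      nonDeg D Q' v + χ (adj (complement G) v v)        ≡⟨ ∑∈-remove Q (λ w → χ (adj (complement G) v w)) Qv ⟨
      nonDeg D Q v                                      ≡⟨ degIn-tabulate (complement G) Q v ⟨
      degIn (complement G) (tabulate Q) v               ≤⟨ deg≤d ⟩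
      d                                                 ∎
      where open ≤-Reasoning

  highOutDegree : ∀ Q → 0 < card Q → ∃ λ v → Q v ≡ true × card Q ≤ 2 * outDeg D Q v + (2 * d + 1)
  highOutDegree Q 0<r with any? (λ v → (Q v Bool.≟ true) ×-dec (card Q ≤? 2 * outDeg D Q v + (2 * d + 1)))
  ... | yes found = found
  ... | no  none  = contradiction (*-cancelʳ-≤ (suc c) c r {{>-nonZero 0<r}}
                      (+-cancelˡ-≤ (2 * arcs D Q) _ _ (≤-trans below (card²≤arcs (card Q) Q refl)))) 1+n≰n
    where
    r = card Q
    c = 2 * d + 1
    below : 2 * arcs D Q + suc c * r ≤ r * r
    below = begin
      2 * arcs D Q + suc c * r
        ≡⟨ cong₂ _+_ (∑∈-*ˡ Q 2 (outDeg D Q)) (∑∈-const Q (suc c)) ⟨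
      ∑[ v ∈ Q ] (2 * outDeg D Q v) + ∑[ v ∈ Q ] suc c
        ≡⟨ ∑∈-+ Q (λ v → 2 * outDeg D Q v) (λ _ → suc c) ⟨
      ∑[ v ∈ Q ] (2 * outDeg D Q v + suc c)
        ≤⟨ ∑∈-mono-≤ Q (λ v Qv → ≤-trans (≤-reflexive (+-suc _ c)) (≰⇒> (λ le → none (v , Qv , le)))) ⟩
      ∑[ v ∈ Q ] r
        ≡⟨ ∑∈-const Q r ⟩
      r * r ∎
      where open ≤-Reasoning

  dominatingSubset : ∀ t Q → card Q + 1 < 2 * d + 2 ^ suc t →
                     ∃ λ S → card S ≤ 2 * d + t × Dominates D S Q
  dominatingSubset zero Q small =
    Q , m≤n⇒m≤n+o 0 (+-cancelʳ-≤ 2 (card Q) (2 * d) (≤-trans (≤-reflexive (+-suc (card Q) 1)) small)) ,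
    (λ _ → inj₁)
  dominatingSubset (suc t) Q small with card Q ≤? 2 * d
  ... | yes |Q|≤2d = Q , m≤n⇒m≤n+o (suc t) |Q|≤2d , (λ _ → inj₁)
  ... | no  |Q|≰2d with highOutDegree Q (≤-trans z<s (≰⇒> |Q|≰2d))
  ... | v , Qv , |Q|≤ with dominatingSubset t Q' 
                  (excess-halves {d = d} {B = 2 ^ suc t}
                     (subst (_≤ 2 * outDeg D Q v + (2 * d + 1)) |Q|≡ |Q|≤)
                     (subst (λ x → x + 1 < 2 * d + 2 ^ suc (suc t)) |Q|≡ small))
    where
    Q' = (Q ∖ ⁅ v ⁆) ∖ arc D v
    |Q|≡ = card-∖closedOutNbhd D Q Qv
  ... | S , |S|≤ , S-dominates = S ∪ ⁅ v ⁆ , size , dominates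
    where
    size : card (S ∪ ⁅ v ⁆) ≤ 2 * d + suc t
    size = begin
      card (S ∪ ⁅ v ⁆)      ≤⟨ card-∪ S ⁅ v ⁆ ⟩
      card S + card ⁅ v ⁆   ≡⟨ cong (card S +_) (card⁅⁆ v) ⟩
      card S + 1            ≤⟨ +-monoˡ-≤ 1 |S|≤ ⟩
      2 * d + t + 1         ≡⟨ trans (+-assoc (2 * d) t 1) (cong (2 * d +_) (+-comm t 1)) ⟩
      2 * d + suc t         ∎
      where open ≤-Reasoning
    dominates : Dominates D (S ∪ ⁅ v ⁆) Q
    dominates u Qu with u ≟ v | arc D v u in v→u
    ... | yes refl | _     = inj₁ (Bool.∨-zeroʳ (S u))
    ... | no  _    | true  = inj₂ (v , ∪-introʳ S ⁅ v ⁆ (⁅⁆-self v) , v→u)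
    ... | no  u≢v  | false
      with S-dominates u (∈-∖ (Q ∖ ⁅ v ⁆) (arc D v) (∈-∖ Q ⁅ v ⁆ Qu (dec-false (u ≟ v) u≢v)) v→u)
    ...   | inj₁ Su            = inj₁ (trans (Bool.∨-identityʳ (S u)) Su)
    ...   | inj₂ (x , Sx , x→u) = inj₂ (x , ∪-introˡ S ⁅ v ⁆ Sx , x→u)

  dominatingSet : 2 * d ≤ n → ∀ t → n ∸ 2 * d + 1 < 2 ^ suc t →
                  ∃ λ S → Dominating D S × ∣ S ∣ ≤ 2 * d + t
  dominatingSet 2d≤n t F<2^[1+t] with dominatingSubset t (λ _ → true) all-fits
    where
    all-fits : card {n} (λ _ → true) + 1 < 2 * d + 2 ^ suc t
    all-fits = begin-strict
      card {n} (λ _ → true) + 1  ≡⟨ cong (_+ 1) card-all ⟩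
      n + 1                      ≡⟨ cong (_+ 1) (m+[n∸m]≡n 2d≤n) ⟨
      2 * d + (n ∸ 2 * d) + 1    ≡⟨ +-assoc (2 * d) (n ∸ 2 * d) 1 ⟩
      2 * d + (n ∸ 2 * d + 1)    <⟨ +-monoʳ-< (2 * d) F<2^[1+t] ⟩
      2 * d + 2 ^ suc t          ∎
      where open ≤-Reasoning
  ... | S , |S|≤2d+t , S-dominates =
    tabulate S , dominating-tabulate D S-dominates , ≤-trans (≤-reflexive (∣tabulate∣≡card S)) |S|≤2d+t

theorem2p6 : (d n : ℕ) → 1 ≤ d → 2 * d + 1 ≤ n → (G : Graph n) → Degenerate d (complement G) → (k : ℕ) → IsOrientedDomNumber G k → LnBound d n k
theorem2p6 d n _ 2d+1≤n G degenerate k ((D , _ , γ-minimal) , _)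
  with log₂-bracket (n ∸ 2 * d + 1) (m≤n+m 1 (n ∸ 2 * d))
... | t , 2^t≤F , F<2^[1+t] with dominatingSet D degenerate (m+n≤o⇒m≤o (2 * d) 2d+1≤n) t F<2^[1+t]
... | S , S-dominating , |S|≤2d+t =
  lnBound d n k (2^suc[k∸[c+1]]≤ (2 * d) t (≤-trans (γ-minimal S S-dominating) |S|≤2d+t)
                                 (2≤n∸m+1 (2 * d) 2d+1≤n) 2^t≤F)
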